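{- Work in a theory containing full comprehension, AC and GC (with global linear order $<$ of the objects). (i) A concept $X$ is finite if and only if $|X|<\omega$. (ii) If there is a least limit point, denoted $\omega$, then $X$ is infinite iff there is an injection $\iota:I_\omega\to X$, which holds iff $|X|\ge\omega$.
   Context: Many-sorted second-order logic (objects; $n$-ary relations, unary ones called concepts) with Henkin semantics, assuming full comprehension for all formulas, the choice schema AC ($[\forall\bar x\,\exists R'\,\varphi(R',\bar x)]\to\exists R\,\forall\bar x\,\varphi(R[\bar x],\bar x)$, $R[\bar x]=\{\bar y:R\bar x\bar y\}$), and global choice GC: a binary relation $<$ on objects which is a linear order such that every formula (parameters allowed) satisfied by some object is satisfied by a $<$-least one. $V=\{x:x=x\}$. $|X|<\omega$ means $X$ is Dedekind-finite (every injection $X\to X$ is a surjection), $|X|\ge\omega$ its negation. $I_a=\{b:b<a\}$, $\overline I_a=\{b:b\le a\}$; $0$ is the $<$-least object; the partial successor is $s(a)=\min_<\{b:b>a\}$; a limit point is $a>0$ such that $b<a$ implies $s(b)<a$. An object $a$ is finite if it is strictly below all limit points; a concept $X$ is finite if it is bijective with $I_a$ or $\overline I_a$ for some finite $a$, and infinite otherwise. -}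

module Defs where

open import Level using (0ℓ)
open import Data.Nat using (ℕ; zero; suc; _+_)
open import Data.Unit using (⊤; tt)
open import Data.Empty using (⊥)
open import Data.Vec using (Vec; []; _∷_; _++_)
open import Data.List using (List; []; _∷_) renaming (_++_ to _++ˡ_)
open import Data.Product using (Σ; ∃; _×_; _,_)
open import Data.Sum using (_⊎_)
open import Relation.Nullary using (¬_)
open import Relation.Binary.PropositionalEquality using (_≡_)
open import Function.Bundles using (_⇔_)

data Sort : Set where
  obj : Sort
  rel : ℕ → Sort          -- n-ary relations on objects (rel 1 = concepts)

Ctx : Set
Ctx = List Sort

data _∋_ : Ctx → Sort → Set where
  here  : ∀ {Γ s} → (s ∷ Γ) ∋ s
  there : ∀ {Γ s t} → Γ ∋ s → (t ∷ Γ) ∋ s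

infixr 5 _⇒̇_
infixr 6 _∨̇_
infixr 7 _∧̇_

data Formula (Γ : Ctx) : Set where
  _≐_  : Γ ∋ obj → Γ ∋ obj → Formula Γ
  _≺̇_  : Γ ∋ obj → Γ ∋ obj → Formula Γ
  app  : ∀ {n} → Γ ∋ rel n → Vec (Γ ∋ obj) n → Formula Γ
  ⊥̇    : Formula Γ
  _⇒̇_ _∧̇_ _∨̇_ : Formula Γ → Formula Γ → Formula Γ
  ∀̇ ∃̇  : (s : Sort) → Formula (s ∷ Γ) → Formula Γ

objs : ℕ → Ctx
objs zero    = []
objs (suc n) = obj ∷ objs n

record Structure : Set₁ where
  field
    Obj     : Set
    Rel     : ℕ → Set                       -- the Henkin range of n-ary relations
    _∈ᴿ_    : ∀ {n} → Vec Obj n → Rel n → Set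
    _≺_     : Obj → Obj → Set
    someObj : Obj

module Semantics (M : Structure) where
  open Structure M

  ⟦_⟧ˢ : Sort → Set
  ⟦ obj ⟧ˢ   = Obj
  ⟦ rel n ⟧ˢ = Rel n

  Env : Ctx → Set
  Env []      = ⊤
  Env (s ∷ Γ) = ⟦ s ⟧ˢ × Env Γ

  lookupEnv : ∀ {Γ s} → Env Γ → Γ ∋ s → ⟦ s ⟧ˢ
  lookupEnv (v , ρ) here      = v
  lookupEnv (v , ρ) (there i) = lookupEnv ρ i

  lookupVec : ∀ {Γ n} → Env Γ → Vec (Γ ∋ obj) n → Vec Obj n
  lookupVec ρ []       = []
  lookupVec ρ (i ∷ is) = lookupEnv ρ i ∷ lookupVec ρ is

  Sat : ∀ {Γ} → Formula Γ → Env Γ → Set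
  Sat (i ≐ j)    ρ = lookupEnv ρ i ≡ lookupEnv ρ j
  Sat (i ≺̇ j)    ρ = lookupEnv ρ i ≺ lookupEnv ρ j
  Sat (app r is) ρ = lookupVec ρ is ∈ᴿ lookupEnv ρ r
  Sat ⊥̇          ρ = ⊥
  Sat (φ ⇒̇ ψ)    ρ = Sat φ ρ → Sat ψ ρ
  Sat (φ ∧̇ ψ)    ρ = Sat φ ρ × Sat ψ ρ
  Sat (φ ∨̇ ψ)    ρ = Sat φ ρ ⊎ Sat ψ ρ
  Sat (∀̇ s φ)    ρ = (v : ⟦ s ⟧ˢ) → Sat φ (v , ρ)
  Sat (∃̇ s φ)    ρ = Σ ⟦ s ⟧ˢ λ v → Sat φ (v , ρ)

  -- bind n object variables (first vector entry = innermost variable)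
  pushObjs : ∀ {n Γ} → Vec Obj n → Env Γ → Env (objs n ++ˡ Γ)
  pushObjs []       ρ = ρ
  pushObjs (x ∷ xs) ρ = x , pushObjs xs ρ

  _≼_ : Obj → Obj → Set
  x ≼ y = x ≺ y ⊎ x ≡ y

record Axioms (M : Structure) : Set₁ where
  open Structure M
  open Semantics M
  field
    comprehension : ∀ (Γ : Ctx) (n : ℕ) (φ : Formula (objs n ++ˡ Γ)) (ρ : Env Γ) →
      ∃ λ (R : Rel n) → ∀ (xs : Vec Obj n) → (xs ∈ᴿ R) ⇔ Sat φ (pushObjs xs ρ)
    -- choice schema: [∀x̄ ∃R' φ(R',x̄)] → ∃R ∀x̄ φ(R[x̄],x̄), where φ(R[x̄],x̄)
    -- is read semantically: φ holds of every R' whose extension is R[x̄]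
    choice : ∀ (Γ : Ctx) (k m : ℕ) (φ : Formula (rel m ∷ (objs k ++ˡ Γ))) (ρ : Env Γ) →
      (∀ (xs : Vec Obj k) → ∃ λ (R' : Rel m) → Sat φ (R' , pushObjs xs ρ)) →
      ∃ λ (R : Rel (k + m)) → ∀ (xs : Vec Obj k) (R' : Rel m) →
        (∀ (ys : Vec Obj m) → (ys ∈ᴿ R') ⇔ ((xs ++ ys) ∈ᴿ R)) →
        Sat φ (R' , pushObjs xs ρ)
    -- global choice: < is a strict linear order ...
    ≺-irrefl : ∀ x → ¬ (x ≺ x)
    ≺-trans  : ∀ x y z → x ≺ y → y ≺ z → x ≺ z
    ≺-total  : ∀ x y → x ≺ y ⊎ x ≡ y ⊎ y ≺ x
    -- ... and every formula satisfied by some object is satisfied by a least one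
    ≺-least  : ∀ (Γ : Ctx) (φ : Formula (obj ∷ Γ)) (ρ : Env Γ) →
      (∃ λ x → Sat φ (x , ρ)) →
      ∃ λ x → Sat φ (x , ρ) × (∀ y → Sat φ (y , ρ) → x ≼ y)

module Notions (M : Structure) where
  open Structure M public
  open Semantics M public

  Pred : Set₁
  Pred = Obj → Set

  _∈_ : Obj → Rel 1 → Set
  x ∈ X = (x ∷ []) ∈ᴿ X

  mem : Rel 1 → Pred
  mem X x = x ∈ X

  Ap : Rel 2 → Obj → Obj → Set
  Ap F x y = (x ∷ y ∷ []) ∈ᴿ F

  IsFun : Rel 2 → Pred → Pred → Set
  IsFun F P Q = (∀ x → P x → ∃ λ y → Q y × Ap F x y)
              × (∀ x y y' → P x → Ap F x y → Ap F x y' → y ≡ y')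

  IsInj : Rel 2 → Pred → Set
  IsInj F P = ∀ x x' y → P x → P x' → Ap F x y → Ap F x' y → x ≡ x'

  IsSurj : Rel 2 → Pred → Pred → Set
  IsSurj F P Q = ∀ y → Q y → ∃ λ x → P x × Ap F x y

  Injection : Rel 2 → Pred → Pred → Set
  Injection F P Q = IsFun F P Q × IsInj F P

  Bijection : Rel 2 → Pred → Pred → Set
  Bijection F P Q = Injection F P Q × IsSurj F P Q

  -- |X| < ω : Dedekind-finite
  DedekindFinite : Rel 1 → Set
  DedekindFinite X = ∀ (F : Rel 2) → Injection F (mem X) (mem X) → IsSurj F (mem X) (mem X)

  -- |X| ≥ ω
  DedekindInfinite : Rel 1 → Set
  DedekindInfinite X = ¬ DedekindFinite X

  I : Obj → Pred
  I a b = b ≺ a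

  Ī : Obj → Pred
  Ī a b = b ≼ a

  IsZero : Obj → Set
  IsZero z = ∀ b → z ≼ b

  IsSucc : Obj → Obj → Set
  IsSucc a b = a ≺ b × (∀ c → a ≺ c → b ≼ c)

  IsLimit : Obj → Set
  IsLimit a = (∀ z → IsZero z → z ≺ a)
            × (∀ b → b ≺ a → ∀ c → IsSucc b c → c ≺ a)

  IsLeastLimit : Obj → Set
  IsLeastLimit ω = IsLimit ω × (∀ l → IsLimit l → ω ≼ l)

  FiniteObj : Obj → Set
  FiniteObj a = ∀ l → IsLimit l → a ≺ l

  FiniteConcept : Rel 1 → Set
  FiniteConcept X = ∃ λ a → FiniteObj a ×
    ((∃ λ F → Bijection F (mem X) (I a)) ⊎ (∃ λ F → Bijection F (mem X) (Ī a)))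

  InfiniteConcept : Rel 1 → Set
  InfiniteConcept X = ¬ FiniteConcept X

module Submission where

-- By induction,
--    I a and Ī a are Dedekind finite for finite a; hence finite concepts are Dedekind finite.
--  * For an infinite concept X we enumerate X: the b-th element is the x ∈ X whose part of X
--    below it is bijective with I b.  Every finite b has a unique b-th element, and distinct
--    finite ranks give distinct elements.  This gives an injection I ω → X, and the
--    "next element" map on the finitely ranked elements is an injection missing min X,
--    which shows that X is Dedekind infinite.
--  * Finally, I ω cannot inject into a finite concept (pigeonhole on Ī d, for finite d < ω).

open import Defs
open import Level using (0ℓ)
open import Data.Unit using (tt)
open import Data.Empty using (⊥; ⊥-elim)
open import Data.Vec using ([]; _∷_)
open import Data.List using ([]; _∷_)
open import Data.Product using (∃; _×_; _,_; proj₁; proj₂)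
open import Data.Sum using (_⊎_; inj₁; inj₂; [_,_])
open import Relation.Nullary using (¬_; Dec; yes; no)
open import Relation.Binary.PropositionalEquality using (_≡_; refl; sym; trans; subst)
open import Function.Bundles using (_⇔_; mk⇔; Equivalence)
open import Axiom.ExcludedMiddle using (ExcludedMiddle)

open Equivalence using (to; from)

Ren : Ctx → Ctx → Set
Ren Γ Δ = ∀ {s} → Γ ∋ s → Δ ∋ s

ext : ∀ {Γ Δ t} → Ren Γ Δ → Ren (t ∷ Γ) (t ∷ Δ)
ext σ here      = here
ext σ (there i) = there (σ i)

ren : ∀ {Γ Δ} → Ren Γ Δ → Formula Γ → Formula Δ
ren σ (i ≐ j)    = σ i ≐ σ j
ren σ (i ≺̇ j)    = σ i ≺̇ σ j
ren σ (app r is) = app (σ r) (Data.Vec.map σ is)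
ren σ ⊥̇          = ⊥̇
ren σ (φ ⇒̇ ψ)    = ren σ φ ⇒̇ ren σ ψ
ren σ (φ ∧̇ ψ)    = ren σ φ ∧̇ ren σ ψ
ren σ (φ ∨̇ ψ)    = ren σ φ ∨̇ ren σ ψ
ren σ (∀̇ s φ)    = ∀̇ s (ren (ext σ) φ)
ren σ (∃̇ s φ)    = ∃̇ s (ren (ext σ) φ)

-- `at P σ v`: the formula P(v), where P has one bound object variable and its parameters are
-- moved along σ.  Used to plug a predicate formula under further quantifiers.
at : ∀ {Γ Δ} → Formula (obj ∷ Γ) → Ren Γ Δ → Δ ∋ obj → Formula Δ
at {Γ} {Δ} P σ v = ren extendBy P
  where
  extendBy : Ren (obj ∷ Γ) Δ
  extendBy here      = v
  extendBy (there i) = σ i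

wk1 : ∀ {Γ a} → Ren Γ (a ∷ Γ)
wk1 i = there i

wk2 : ∀ {Γ a b} → Ren Γ (a ∷ b ∷ Γ)
wk2 i = there (there i)

wk3 : ∀ {Γ a b c} → Ren Γ (a ∷ b ∷ c ∷ Γ)
wk3 i = there (there (there i))

v0 : ∀ {Γ s} → (s ∷ Γ) ∋ s
v0 = here

v1 : ∀ {Γ s a} → (a ∷ s ∷ Γ) ∋ s
v1 = there v0

v2 : ∀ {Γ s a b} → (a ∷ b ∷ s ∷ Γ) ∋ s
v2 = there v1

v3 : ∀ {Γ s a b c} → (a ∷ b ∷ c ∷ s ∷ Γ) ∋ s
v3 = there v2

v4 : ∀ {Γ s a b c d} → (a ∷ b ∷ c ∷ d ∷ s ∷ Γ) ∋ s
v4 = there v3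

-- Object-language versions of the notions of Defs; under Sat each unfolds definitionally
-- to its semantic counterpart (e.g. Sat (InjF G P Q) ρ is Injection G ⟦P⟧ ⟦Q⟧).
¬̇_ : ∀ {Γ} → Formula Γ → Formula Γ
¬̇ φ = φ ⇒̇ ⊥̇

_≼̇_ : ∀ {Γ} → Γ ∋ obj → Γ ∋ obj → Formula Γ
x ≼̇ y = x ≺̇ y ∨̇ x ≐ y

ap1 : ∀ {Γ} → Γ ∋ rel 1 → Γ ∋ obj → Formula Γ
ap1 X x = app X (x ∷ [])

ap2 : ∀ {Γ} → Γ ∋ rel 2 → Γ ∋ obj → Γ ∋ obj → Formula Γ
ap2 G x y = app G (x ∷ y ∷ [])

IsFunF : ∀ {Γ} → Γ ∋ rel 2 → Formula (obj ∷ Γ) → Formula (obj ∷ Γ) → Formula Γ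
IsFunF G P Q =
  ∀̇ obj (at P wk1 v0 ⇒̇ ∃̇ obj (at Q wk2 v0 ∧̇ ap2 (wk2 G) v1 v0))
  ∧̇ ∀̇ obj (∀̇ obj (∀̇ obj (at P wk3 v2 ⇒̇ ap2 (wk3 G) v2 v1 ⇒̇ ap2 (wk3 G) v2 v0 ⇒̇ v1 ≐ v0)))

IsInjF : ∀ {Γ} → Γ ∋ rel 2 → Formula (obj ∷ Γ) → Formula Γ
IsInjF G P =
  ∀̇ obj (∀̇ obj (∀̇ obj
    (at P wk3 v2 ⇒̇ at P wk3 v1 ⇒̇ ap2 (wk3 G) v2 v0 ⇒̇ ap2 (wk3 G) v1 v0 ⇒̇ v2 ≐ v1)))

IsSurjF : ∀ {Γ} → Γ ∋ rel 2 → Formula (obj ∷ Γ) → Formula (obj ∷ Γ) → Formula Γ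
IsSurjF G P Q = ∀̇ obj (at Q wk1 v0 ⇒̇ ∃̇ obj (at P wk2 v0 ∧̇ ap2 (wk2 G) v0 v1))

InjF : ∀ {Γ} → Γ ∋ rel 2 → Formula (obj ∷ Γ) → Formula (obj ∷ Γ) → Formula Γ
InjF G P Q = IsFunF G P Q ∧̇ IsInjF G P

BijF : ∀ {Γ} → Γ ∋ rel 2 → Formula (obj ∷ Γ) → Formula (obj ∷ Γ) → Formula Γ
BijF G P Q = InjF G P Q ∧̇ IsSurjF G P Q

LimitF : ∀ {Γ} → Formula (obj ∷ Γ)
LimitF =
  ∀̇ obj (∀̇ obj (v1 ≼̇ v0) ⇒̇ v0 ≺̇ v1)
  ∧̇ ∀̇ obj (v0 ≺̇ v1 ⇒̇ ∀̇ obj ((v1 ≺̇ v0 ∧̇ ∀̇ obj (v2 ≺̇ v0 ⇒̇ v1 ≼̇ v0)) ⇒̇ v0 ≺̇ v2))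

FiniteF : ∀ {Γ} → Formula (obj ∷ Γ)
FiniteF = ∀̇ obj (LimitF ⇒̇ v1 ≺̇ v0)

module Proposition4 (em : ExcludedMiddle 0ℓ) (M : Structure) (AX : Axioms M) where
  open Notions M
  open Axioms AX

  decide : (A : Set) → Dec A
  decide A = em

  ≺≼-trans : ∀ {x y z} → x ≺ y → y ≼ z → x ≺ z
  ≺≼-trans {x} {y} {z} x<y (inj₁ y<z) = ≺-trans x y z x<y y<z
  ≺≼-trans x<y (inj₂ refl) = x<y

  ≼≺-trans : ∀ {x y z} → x ≼ y → y ≺ z → x ≺ z
  ≼≺-trans {x} {y} {z} (inj₁ x<y) y<z = ≺-trans x y z x<y y<z
  ≼≺-trans (inj₂ refl) y<z = y<z

  ≼⇒≯ : ∀ {x y} → x ≼ y → ¬ (y ≺ x)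
  ≼⇒≯ {x} x≼y y<x = ≺-irrefl x (≼≺-trans x≼y y<x)

  ≯⇒≼ : ∀ {x y} → ¬ (y ≺ x) → x ≼ y
  ≯⇒≼ {x} {y} y≮x with ≺-total x y
  ... | inj₁ x<y = inj₁ x<y
  ... | inj₂ (inj₁ x≡y) = inj₂ x≡y
  ... | inj₂ (inj₂ y<x) = ⊥-elim (y≮x y<x)

  ≼-antisym : ∀ {x y} → x ≼ y → y ≼ x → x ≡ y
  ≼-antisym (inj₂ x≡y) _ = x≡y
  ≼-antisym (inj₁ x<y) y≼x = ⊥-elim (≼⇒≯ y≼x x<y)

  ≡-from-≮ : ∀ {x y} → ¬ (x ≺ y) → ¬ (y ≺ x) → x ≡ y
  ≡-from-≮ x≮y y≮x = ≼-antisym (≯⇒≼ y≮x) (≯⇒≼ x≮y)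

  concept : ∀ Γ (φ : Formula (obj ∷ Γ)) (ρ : Env Γ) →
            ∃ λ (A : Rel 1) → ∀ x → x ∈ A ⇔ Sat φ (x , ρ)
  concept Γ φ ρ = let (A , A-spec) = comprehension Γ 1 φ ρ in A , λ x → A-spec (x ∷ [])

  relation : ∀ Γ (φ : Formula (obj ∷ obj ∷ Γ)) (ρ : Env Γ) →
             ∃ λ (R : Rel 2) → ∀ x y → Ap R x y ⇔ Sat φ (x , y , ρ)
  relation Γ φ ρ = let (R , R-spec) = comprehension Γ 2 φ ρ in R , λ x y → R-spec (x ∷ y ∷ [])

  -- Some binary relation (the empty one); any relation is a bijection between empty predicates.
  someRelation : Rel 2
  someRelation = proj₁ (relation [] ⊥̇ tt)

  IsConcept : Pred → Set
  IsConcept P = ∃ λ (A : Rel 1) → ∀ x → x ∈ A ⇔ P x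

  concept-mem : ∀ X → IsConcept (mem X)
  concept-mem X = X , λ x → mk⇔ (λ x∈X → x∈X) (λ x∈X → x∈X)

  segment-concept : ∀ a → IsConcept (I a)
  segment-concept a = concept (obj ∷ []) (v0 ≺̇ v1) (a , tt)

  closedSegment-concept : ∀ a → IsConcept (Ī a)
  closedSegment-concept a = concept (obj ∷ []) (v0 ≼̇ v1) (a , tt)

  zero-exists : ∃ IsZero
  zero-exists with ≺-least [] (⊥̇ ⇒̇ ⊥̇) tt (someObj , λ ())
  ... | z , _ , z-least = z , λ b → z-least b (λ ())

  successor-exists : ∀ {a y} → a ≺ y → ∃ (IsSucc a)
  successor-exists {a} {y} a<y with ≺-least (obj ∷ []) (v1 ≺̇ v0) (a , tt) (y , a<y)
  ... | c , a<c , c-least = c , a<c , c-least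

  _⊆_ : Pred → Pred → Set
  P ⊆ Q = ∀ x → P x → Q x

  _≗_ : Pred → Pred → Set
  P ≗ Q = P ⊆ Q × Q ⊆ P

  ⊆-refl : ∀ {P} → P ⊆ P
  ⊆-refl _ Px = Px

  ≗-refl : ∀ {P} → P ≗ P
  ≗-refl = ⊆-refl , ⊆-refl

  ≗-sym : ∀ {P Q} → P ≗ Q → Q ≗ P
  ≗-sym (P⊆Q , Q⊆P) = Q⊆P , P⊆Q

  zero-segment-empty : ∀ {z} → IsZero z → ∀ x → ¬ I z x
  zero-segment-empty z0 x = ≼⇒≯ (z0 x)

  succ-segment : ∀ {b c} → IsSucc b c → I c ≗ Ī b
  succ-segment {b} {c} (b<c , c-least) = below , above
    where
    below : I c ⊆ Ī b
    below x x<c with ≺-total x b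
    ... | inj₁ x<b = inj₁ x<b
    ... | inj₂ (inj₁ x≡b) = inj₂ x≡b
    ... | inj₂ (inj₂ b<x) = ⊥-elim (≼⇒≯ (c-least x b<x) x<c)
    above : Ī b ⊆ I c
    above x x≤b = ≼≺-trans x≤b b<c

  fun-value : ∀ {F P Q x y} → IsFun F P Q → P x → Ap F x y → Q y
  fun-value {x = x} {y} (total , functional) Px Fxy =
    let (y' , Qy' , Fxy') = total x Px in subst _ (functional x y' y Px Fxy' Fxy) Qy'

  injection-mono : ∀ {F P Q P' Q'} → Injection F P Q → P' ⊆ P → Q ⊆ Q' → Injection F P' Q'
  injection-mono ((total , functional) , injective) P'⊆P Q⊆Q' =
    ((λ x P'x → let (y , Qy , Fxy) = total x (P'⊆P x P'x) in y , Q⊆Q' y Qy , Fxy) ,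
     (λ x y y' P'x → functional x y y' (P'⊆P x P'x))) ,
    (λ x x' y P'x P'x' → injective x x' y (P'⊆P x P'x) (P'⊆P x' P'x'))

  bijection-resp : ∀ {F P Q P' Q'} → Bijection F P Q → P ≗ P' → Q ≗ Q' → Bijection F P' Q'
  bijection-resp (jF , surjective) (P⊆P' , P'⊆P) (Q⊆Q' , Q'⊆Q) =
    injection-mono jF P'⊆P Q⊆Q' ,
    λ y Q'y → let (x , Px , Fxy) = surjective y (Q'⊆Q y Q'y) in x , P⊆P' x Px , Fxy

  vacuous-bijection : ∀ {P Q} (F : Rel 2) → (∀ x → ¬ P x) → (∀ y → ¬ Q y) → Bijection F P Q
  vacuous-bijection F P-empty Q-empty =
    (((λ x Px → ⊥-elim (P-empty x Px)) , (λ x _ _ Px → ⊥-elim (P-empty x Px))) ,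
     (λ x _ _ Px → ⊥-elim (P-empty x Px))) ,
    (λ y Qy → ⊥-elim (Q-empty y Qy))

  compose : ∀ (F G : Rel 2) → ∃ λ (H : Rel 2) → ∀ x z → Ap H x z ⇔ (∃ λ y → Ap F x y × Ap G y z)
  compose F G = relation (rel 2 ∷ rel 2 ∷ []) (∃̇ obj (ap2 v3 v1 v0 ∧̇ ap2 v4 v0 v2)) (F , G , tt)

  injection-compose : ∀ {F G H P Q R} → Injection F P Q → Injection G Q R →
                      (∀ x z → Ap H x z ⇔ (∃ λ y → Ap F x y × Ap G y z)) → Injection H P R
  injection-compose {F} {G} {H} {P} {Q} {R} jF@(fF , injF) (fG@(_ , functionalG) , injG) H-spec =
    (total , functional) , injective
    where
    total : ∀ x → P x → ∃ λ z → R z × Ap H x z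
    total x Px =
      let (y , Qy , Fxy) = proj₁ fF x Px
          (z , Rz , Gyz) = proj₁ fG y Qy
      in z , Rz , from (H-spec x z) (y , Fxy , Gyz)
    functional : ∀ x z z' → P x → Ap H x z → Ap H x z' → z ≡ z'
    functional x z z' Px Hxz Hxz' with to (H-spec x z) Hxz | to (H-spec x z') Hxz'
    ... | y , Fxy , Gyz | y' , Fxy' , Gy'z' with proj₂ fF x y y' Px Fxy Fxy'
    ... | refl = functionalG y z z' (fun-value fF Px Fxy) Gyz Gy'z'
    injective : IsInj H P
    injective x x' z Px Px' Hxz Hx'z with to (H-spec x z) Hxz | to (H-spec x' z) Hx'z
    ... | y , Fxy , Gyz | y' , Fx'y' , Gy'z
      with injG y y' z (fun-value fF Px Fxy) (fun-value fF Px' Fx'y') Gyz Gy'z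
    ... | refl = injF x x' y Px Px' Fxy Fx'y'

  compose-injections : ∀ {F G P Q R} → Injection F P Q → Injection G Q R →
                       ∃ λ H → Injection H P R
  compose-injections {F} {G} jF jG =
    let (H , H-spec) = compose F G in H , injection-compose jF jG H-spec

  -- A bijection out of a concept has an inverse (the concept restricts the converse relation).
  inverse : ∀ {F P Q} → IsConcept P → Bijection F P Q → ∃ λ F' → Bijection F' Q P
  inverse {F} {P} {Q} (A , A-spec) (((total , functional) , injective) , surjective) =
    F' , ((total' , functional') , injective') , surjective'
    where
    converse : ∃ λ (F' : Rel 2) → ∀ y x → Ap F' y x ⇔ (Ap F x y × x ∈ A)
    converse = relation (rel 2 ∷ rel 1 ∷ []) (ap2 v2 v1 v0 ∧̇ ap1 v3 v1) (F , A , tt)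
    F' : Rel 2
    F' = proj₁ converse
    F'-spec : ∀ y x → Ap F' y x → Ap F x y × P x
    F'-spec y x F'yx = let (Fxy , x∈A) = to (proj₂ converse y x) F'yx in Fxy , to (A-spec x) x∈A
    total' : ∀ y → Q y → ∃ λ x → P x × Ap F' y x
    total' y Qy = let (x , Px , Fxy) = surjective y Qy
                  in x , Px , from (proj₂ converse y x) (Fxy , from (A-spec x) Px)
    functional' : ∀ y x x' → Q y → Ap F' y x → Ap F' y x' → x ≡ x'
    functional' y x x' _ F'yx F'yx' =
      let (Fxy , Px) = F'-spec y x F'yx ; (Fx'y , Px') = F'-spec y x' F'yx'
      in injective x x' y Px Px' Fxy Fx'y
    injective' : IsInj F' Q
    injective' y y' x _ _ F'yx F'y'x =
      let (Fxy , Px) = F'-spec y x F'yx ; (Fxy' , _) = F'-spec y' x F'y'x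
      in functional x y y' Px Fxy Fxy'
    surjective' : IsSurj F' Q P
    surjective' x Px = let (y , Qy , Fxy) = total x Px
                       in y , Qy , from (proj₂ converse y x) (Fxy , from (A-spec x) Px)

  extend : ∀ {G P Q p q} → Bijection G P Q → ¬ P p → ¬ Q q →
           ∃ λ G' → Bijection G' (λ x → P x ⊎ x ≡ p) (λ y → Q y ⊎ y ≡ q)
  extend {G} {P} {Q} {p} {q} (((total , functional) , injective) , surjective) p∉P q∉Q =
    G' , ((total' , functional') , injective') , surjective'
    where
    P' Q' : Pred
    P' x = P x ⊎ x ≡ p
    Q' y = Q y ⊎ y ≡ q
    graph : ∃ λ (G' : Rel 2) → ∀ x z → Ap G' x z ⇔ ((¬ x ≡ p × Ap G x z) ⊎ (x ≡ p × z ≡ q))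
    graph = relation (rel 2 ∷ obj ∷ obj ∷ [])
              ((¬̇ (v0 ≐ v3) ∧̇ ap2 v2 v0 v1) ∨̇ (v0 ≐ v3 ∧̇ v1 ≐ v4)) (G , p , q , tt)
    G' : Rel 2
    G' = proj₁ graph
    G'-spec : ∀ x z → Ap G' x z ⇔ ((¬ x ≡ p × Ap G x z) ⊎ (x ≡ p × z ≡ q))
    G'-spec = proj₂ graph
    old : ∀ {x} → P' x → ¬ x ≡ p → P x
    old (inj₁ Px) _ = Px
    old (inj₂ x≡p) x≢p = ⊥-elim (x≢p x≡p)
    old-value : ∀ {x z} → P' x → ¬ x ≡ p → Ap G x z → ¬ z ≡ q
    old-value P'x x≢p Gxz refl = q∉Q (fun-value (total , functional) (old P'x x≢p) Gxz)
    total' : ∀ x → P' x → ∃ λ z → Q' z × Ap G' x z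
    total' x (inj₂ x≡p) = q , inj₂ refl , from (G'-spec x q) (inj₂ (x≡p , refl))
    total' x (inj₁ Px) = let (z , Qz , Gxz) = total x Px
                         in z , inj₁ Qz , from (G'-spec x z) (inj₁ ((λ { refl → p∉P Px }) , Gxz))
    functional' : ∀ x z z' → P' x → Ap G' x z → Ap G' x z' → z ≡ z'
    functional' x z z' P'x G'xz G'xz' with to (G'-spec x z) G'xz | to (G'-spec x z') G'xz'
    ... | inj₁ (x≢p , Gxz) | inj₁ (_ , Gxz') = functional x z z' (old P'x x≢p) Gxz Gxz'
    ... | inj₁ (x≢p , _) | inj₂ (x≡p , _) = ⊥-elim (x≢p x≡p)
    ... | inj₂ (x≡p , _) | inj₁ (x≢p , _) = ⊥-elim (x≢p x≡p)
    ... | inj₂ (_ , z≡q) | inj₂ (_ , z'≡q) = trans z≡q (sym z'≡q)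
    injective' : IsInj G' P'
    injective' x x' z P'x P'x' G'xz G'x'z with to (G'-spec x z) G'xz | to (G'-spec x' z) G'x'z
    ... | inj₁ (x≢p , Gxz) | inj₁ (x'≢p , Gx'z) =
      injective x x' z (old P'x x≢p) (old P'x' x'≢p) Gxz Gx'z
    ... | inj₁ (x≢p , Gxz) | inj₂ (_ , z≡q) = ⊥-elim (old-value P'x x≢p Gxz z≡q)
    ... | inj₂ (_ , z≡q) | inj₁ (x'≢p , Gx'z) = ⊥-elim (old-value P'x' x'≢p Gx'z z≡q)
    ... | inj₂ (x≡p , _) | inj₂ (x'≡p , _) = trans x≡p (sym x'≡p)
    surjective' : IsSurj G' P' Q'
    surjective' z (inj₂ z≡q) = p , inj₂ refl , from (G'-spec p z) (inj₂ (refl , z≡q))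
    surjective' z (inj₁ Qz) = let (x , Px , Gxz) = surjective z Qz
                              in x , inj₁ Px , from (G'-spec x z) (inj₁ ((λ { refl → p∉P Px }) , Gxz))

  DFin : Pred → Set
  DFin P = ∀ F → Injection F P P → IsSurj F P P

  DFin-resp : ∀ {P Q} → P ≗ Q → DFin P → DFin Q
  DFin-resp (P⊆Q , Q⊆P) dP F jF y Qy =
    let (x , Px , Fxy) = dP F (injection-mono jF P⊆Q Q⊆P) y (Q⊆P y Qy) in x , P⊆Q x Px , Fxy

  pigeonhole : ∀ {H P Q q} → DFin Q → Injection H Q P → P ⊆ Q → Q q → ¬ P q → ⊥
  pigeonhole {H} {q = q} dQ jH P⊆Q Qq q∉P =
    let (x , Qx , Hxq) = dQ H (injection-mono jH ⊆-refl P⊆Q) q Qq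
    in q∉P (fun-value (proj₁ jH) Qx Hxq)

  -- Dedekind finiteness is transported along a bijection out of a concept: an injection G of
  -- Q into itself is conjugated to the injection F ; G ; F⁻¹ of P into itself, which is onto.
  transfer : ∀ {F P Q} → IsConcept P → Bijection F P Q → DFin P → DFin Q
  transfer {F} cP bF dP G jG y Qy with inverse cP bF
  ... | F⁻¹ , bF⁻¹ with compose F G
  ... | FG , FG-spec with compose FG F⁻¹
  ... | H , H-spec with proj₁ (proj₁ (proj₁ bF⁻¹)) y Qy
  ... | p , Pp , F⁻¹yp
    with dP H (injection-compose (injection-compose (proj₁ bF) jG FG-spec) (proj₁ bF⁻¹) H-spec) p Pp
  ... | p' , Pp' , Hp'p with to (H-spec p' p) Hp'p
  ... | u , FGp'u , F⁻¹up with to (FG-spec p' u) FGp'u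
  ... | w , Fp'w , Gwu = w , Qw , subst (Ap G w) u≡y Gwu
    where
    Qw = fun-value (proj₁ (proj₁ bF)) Pp' Fp'w
    u≡y = proj₂ (proj₁ bF⁻¹) u y p (fun-value (proj₁ jG) Qw Gwu) Qy F⁻¹up F⁻¹yp

  redirect : ∀ (F : Rel 2) (p q : Obj) → ∃ λ (G : Rel 2) → ∀ x z →
             Ap G x z ⇔ ((Ap F x z × ¬ z ≡ p) ⊎ (Ap F x p × z ≡ q))
  redirect F p q = relation (rel 2 ∷ obj ∷ obj ∷ [])
    ((ap2 v2 v0 v1 ∧̇ ¬̇ (v1 ≐ v3)) ∨̇ (ap2 v2 v0 v3 ∧̇ v1 ≐ v4)) (F , p , q , tt)

  -- For F injective on A ∪ {p} with F p = q, the
  -- relation G = F with value p redirected to q maps A injectively into A, so it is onto A,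
  -- and every point of A ∪ {p} is then seen to be a value of F.
  addPoint-surjective : ∀ {A p q F} → DFin A → ¬ A p → Injection F (λ x → A x ⊎ x ≡ p) (λ x → A x ⊎ x ≡ p) →
                        A q ⊎ q ≡ p → Ap F p q → IsSurj F (λ x → A x ⊎ x ≡ p) (λ x → A x ⊎ x ≡ p)
  addPoint-surjective {A} {p} {q} {F} dA p∉A ((total , functional) , injective) Bq Fpq = surjective
    where
    G : Rel 2
    G = proj₁ (redirect F p q)
    G-spec : ∀ x z → Ap G x z ⇔ ((Ap F x z × ¬ z ≡ p) ⊎ (Ap F x p × z ≡ q))
    G-spec = proj₂ (redirect F p q)
    avoids-q : ∀ x → A x → ¬ Ap F x q
    avoids-q x Ax Fxq with injective x p q (inj₁ Ax) (inj₂ refl) Fxq Fpq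
    ... | refl = p∉A Ax
    q∈A : ∀ x → A x → Ap F x p → A q
    q∈A x Ax Fxp = [ (λ Aq → Aq) , (λ q≡p → ⊥-elim (avoids-q x Ax (subst (Ap F x) (sym q≡p) Fxp))) ] Bq
    G-total : ∀ x → A x → ∃ λ z → A z × Ap G x z
    G-total x Ax with total x (inj₁ Ax)
    ... | z , inj₁ Az , Fxz = z , Az , from (G-spec x z) (inj₁ (Fxz , λ { refl → p∉A Az }))
    ... | z , inj₂ refl , Fxp = q , q∈A x Ax Fxp , from (G-spec x q) (inj₂ (Fxp , refl))
    G-functional : ∀ x z z' → A x → Ap G x z → Ap G x z' → z ≡ z'
    G-functional x z z' Ax Gxz Gxz' with to (G-spec x z) Gxz | to (G-spec x z') Gxz'
    ... | inj₁ (Fxz , _) | inj₁ (Fxz' , _) = functional x z z' (inj₁ Ax) Fxz Fxz'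
    ... | inj₁ (Fxz , z≢p) | inj₂ (Fxp , _) = ⊥-elim (z≢p (functional x z p (inj₁ Ax) Fxz Fxp))
    ... | inj₂ (Fxp , _) | inj₁ (Fxz' , z'≢p) = ⊥-elim (z'≢p (functional x z' p (inj₁ Ax) Fxz' Fxp))
    ... | inj₂ (_ , z≡q) | inj₂ (_ , z'≡q) = trans z≡q (sym z'≡q)
    G-injective : IsInj G A
    G-injective x x' z Ax Ax' Gxz Gx'z with to (G-spec x z) Gxz | to (G-spec x' z) Gx'z
    ... | inj₁ (Fxz , _) | inj₁ (Fx'z , _) = injective x x' z (inj₁ Ax) (inj₁ Ax') Fxz Fx'z
    ... | inj₁ (Fxz , _) | inj₂ (_ , refl) = ⊥-elim (avoids-q x Ax Fxz)
    ... | inj₂ (_ , refl) | inj₁ (Fx'z , _) = ⊥-elim (avoids-q x' Ax' Fx'z)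
    ... | inj₂ (Fxp , _) | inj₂ (Fx'p , _) = injective x x' p (inj₁ Ax) (inj₁ Ax') Fxp Fx'p
    G-surjective : IsSurj G A A
    G-surjective = dA G ((G-total , G-functional) , G-injective)
    surjective : IsSurj F (λ x → A x ⊎ x ≡ p) (λ x → A x ⊎ x ≡ p)
    surjective y (inj₁ Ay) with G-surjective y Ay
    ... | x , Ax , Gxy with to (G-spec x y) Gxy
    ...   | inj₁ (Fxy , _) = x , inj₁ Ax , Fxy
    ...   | inj₂ (_ , refl) = p , inj₂ refl , Fpq
    surjective y (inj₂ refl) = p-attained Bq
      where
      p-attained : A q ⊎ q ≡ p → ∃ λ x → (A x ⊎ x ≡ p) × Ap F x p
      p-attained (inj₂ q≡p) = p , inj₂ refl , subst (Ap F p) q≡p Fpq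
      p-attained (inj₁ Aq) with G-surjective q Aq
      ... | x , Ax , Gxq with to (G-spec x q) Gxq
      ...   | inj₁ (Fxq , _) = ⊥-elim (avoids-q x Ax Fxq)
      ...   | inj₂ (Fxp , _) = x , inj₁ Ax , Fxp

  dfin-addPoint : ∀ {A p} → DFin A → ¬ A p → DFin (λ x → A x ⊎ x ≡ p)
  dfin-addPoint {p = p} dA p∉A F jF =
    let (q , Bq , Fpq) = proj₁ (proj₁ jF) p (inj₂ refl) in addPoint-surjective dA p∉A jF Bq Fpq

  -- An injection F of a subconcept C ⊆ X into itself extends, by the identity outside C, to an
  -- injection G of X into itself whose values in C are attained only as values of F.
  identity-extension : ∀ (C X : Rel 1) {F} → mem C ⊆ mem X → Injection F (mem C) (mem C) →
    ∃ λ G → Injection G (mem X) (mem X) × (∀ x y → Ap G x y → y ∈ C → x ∈ C × Ap F x y)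
  identity-extension C X {F} C⊆X jF@((total , functional) , injective) =
    G , ((G-total , G-functional) , G-injective) , G-into-C
    where
    graph : ∃ λ (G : Rel 2) → ∀ x z → Ap G x z ⇔ ((x ∈ C × Ap F x z) ⊎ (¬ x ∈ C × z ≡ x))
    graph = relation (rel 1 ∷ rel 2 ∷ [])
              ((ap1 v2 v0 ∧̇ ap2 v3 v0 v1) ∨̇ (¬̇ ap1 v2 v0 ∧̇ v1 ≐ v0)) (C , F , tt)
    G : Rel 2
    G = proj₁ graph
    G-spec : ∀ x z → Ap G x z ⇔ ((x ∈ C × Ap F x z) ⊎ (¬ x ∈ C × z ≡ x))
    G-spec = proj₂ graph
    G-total : ∀ x → x ∈ X → ∃ λ z → z ∈ X × Ap G x z
    G-total x x∈X with decide (x ∈ C)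
    ... | yes x∈C = let (z , z∈C , Fxz) = total x x∈C
                    in z , C⊆X z z∈C , from (G-spec x z) (inj₁ (x∈C , Fxz))
    ... | no x∉C = x , x∈X , from (G-spec x x) (inj₂ (x∉C , refl))
    G-functional : ∀ x z z' → x ∈ X → Ap G x z → Ap G x z' → z ≡ z'
    G-functional x z z' _ Gxz Gxz' with to (G-spec x z) Gxz | to (G-spec x z') Gxz'
    ... | inj₁ (x∈C , Fxz) | inj₁ (_ , Fxz') = functional x z z' x∈C Fxz Fxz'
    ... | inj₁ (x∈C , _) | inj₂ (x∉C , _) = ⊥-elim (x∉C x∈C)
    ... | inj₂ (x∉C , _) | inj₁ (x∈C , _) = ⊥-elim (x∉C x∈C)
    ... | inj₂ (_ , z≡x) | inj₂ (_ , z'≡x) = trans z≡x (sym z'≡x)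
    G-injective : IsInj G (mem X)
    G-injective x x' z _ _ Gxz Gx'z with to (G-spec x z) Gxz | to (G-spec x' z) Gx'z
    ... | inj₁ (x∈C , Fxz) | inj₁ (x'∈C , Fx'z) = injective x x' z x∈C x'∈C Fxz Fx'z
    ... | inj₁ (x∈C , Fxz) | inj₂ (x'∉C , refl) = ⊥-elim (x'∉C (fun-value (proj₁ jF) x∈C Fxz))
    ... | inj₂ (x∉C , refl) | inj₁ (x'∈C , Fx'z) = ⊥-elim (x∉C (fun-value (proj₁ jF) x'∈C Fx'z))
    ... | inj₂ (_ , z≡x) | inj₂ (_ , z≡x') = trans (sym z≡x) z≡x'
    G-into-C : ∀ x y → Ap G x y → y ∈ C → x ∈ C × Ap F x y
    G-into-C x y Gxy y∈C with to (G-spec x y) Gxy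
    ... | inj₁ x∈C×Fxy = x∈C×Fxy
    ... | inj₂ (x∉C , refl) = ⊥-elim (x∉C y∈C)

  dfin-subconcept : ∀ (C X : Rel 1) → mem C ⊆ mem X → DFin (mem X) → DFin (mem C)
  dfin-subconcept C X C⊆X dX F jF y y∈C =
    let (G , jG , G-into-C) = identity-extension C X C⊆X jF
        (x , _ , Gxy) = dX G jG y (C⊆X y y∈C)
        (x∈C , Fxy) = G-into-C x y Gxy y∈C
    in x , x∈C , Fxy

  fin-down : ∀ {a b} → FiniteObj a → b ≼ a → FiniteObj b
  fin-down fa b≤a l l-limit = ≼≺-trans b≤a (fa l l-limit)

  fin-succ : ∀ {a c} → FiniteObj a → IsSucc a c → FiniteObj c
  fin-succ {a} fa sac l l-limit = proj₂ l-limit a (fa l l-limit) _ sac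

  -- A finite nonzero object a has a predecessor: otherwise a would be a limit point, and a < a.
  predecessor : ∀ {a} → FiniteObj a → ¬ IsZero a → ∃ λ b → IsSucc b a
  predecessor {a} fa a≠0 with decide (∃ λ b → b ≺ a × ∃ λ c → IsSucc b c × ¬ c ≺ a)
  ... | yes (b , b<a , c , sbc , c≮a) =
    b , subst (IsSucc b) (≼-antisym (proj₂ sbc a b<a) (≯⇒≼ c≮a)) sbc
  ... | no no-predecessor = ⊥-elim (≺-irrefl a (fa a (above-zero , closed)))
    where
    above-zero : ∀ z → IsZero z → z ≺ a
    above-zero z z0 with z0 a
    ... | inj₁ z<a = z<a
    ... | inj₂ refl = ⊥-elim (a≠0 z0)
    closed : ∀ b → b ≺ a → ∀ c → IsSucc b c → c ≺ a
    closed b b<a c sbc with decide (c ≺ a)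
    ... | yes c<a = c<a
    ... | no c≮a = ⊥-elim (no-predecessor (b , b<a , c , sbc , c≮a))

  -- Induction over finite objects for definable properties: a least counterexample would be
  -- finite, and neither 0 nor a successor.
  finite-induction : ∀ Γ (φ : Formula (obj ∷ Γ)) (ρ : Env Γ) →
    (∀ z → IsZero z → Sat φ (z , ρ)) →
    (∀ b c → FiniteObj b → IsSucc b c → Sat φ (b , ρ) → Sat φ (c , ρ)) →
    ∀ a → FiniteObj a → Sat φ (a , ρ)
  finite-induction Γ φ ρ base step a fa with decide (Sat φ (a , ρ))
  ... | yes φa = φa
  ... | no ¬φa with ≺-least Γ (¬̇ φ) ρ (a , ¬φa)
  ... | c , ¬φc , c-least = ⊥-elim (¬φc φc)
    where
    c-finite : FiniteObj c
    c-finite = fin-down fa (c-least a ¬φa)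
    below-c : ∀ b → b ≺ c → Sat φ (b , ρ)
    below-c b b<c with decide (Sat φ (b , ρ))
    ... | yes φb = φb
    ... | no ¬φb = ⊥-elim (≼⇒≯ (c-least b ¬φb) b<c)
    φc : Sat φ (c , ρ)
    φc with decide (IsZero c)
    ... | yes c0 = base c c0
    ... | no c≠0 with predecessor c-finite c≠0
    ... | b , sbc = step b c (fin-down c-finite (inj₁ (proj₁ sbc))) sbc (below-c b (proj₁ sbc))

  -- Segments of finite objects are Dedekind finite (induction on a, adding one point at a time).
  segment-dfin : ∀ {a} → FiniteObj a → DFin (I a)
  segment-dfin {a} fa = finite-induction [] DFinSegmentF tt empty-case successor-case a fa
    where
    DFinSegmentF : Formula (obj ∷ [])
    DFinSegmentF = ∀̇ (rel 2) (InjF v0 (v0 ≺̇ v2) (v0 ≺̇ v2) ⇒̇ IsSurjF v0 (v0 ≺̇ v2) (v0 ≺̇ v2))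
    empty-case : ∀ z → IsZero z → DFin (I z)
    empty-case z z0 _ _ y y<z = ⊥-elim (zero-segment-empty z0 y y<z)
    successor-case : ∀ b c → FiniteObj b → IsSucc b c → DFin (I b) → DFin (I c)
    successor-case b c _ sbc dIb = DFin-resp (≗-sym (succ-segment sbc)) (dfin-addPoint dIb (≺-irrefl b))

  -- Ī a = I a ∪ {a}.
  closedSegment-dfin : ∀ {a} → FiniteObj a → DFin (Ī a)
  closedSegment-dfin {a} fa = dfin-addPoint (segment-dfin fa) (≺-irrefl a)

  finite⇒dfin : ∀ X → FiniteConcept X → DedekindFinite X
  finite⇒dfin X (a , fa , inj₁ (F , bF)) =
    transfer (segment-concept a) (proj₂ (inverse (concept-mem X) bF)) (segment-dfin fa)
  finite⇒dfin X (a , fa , inj₂ (F , bF)) =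
    transfer (closedSegment-concept a) (proj₂ (inverse (concept-mem X) bF)) (closedSegment-dfin fa)

  module Enumeration (X : Rel 1) (X-infinite : ¬ FiniteConcept X) where

    Below : Obj → Pred
    Below x y = y ∈ X × y ≺ x

    -- x is the b-th element of X: the part of X below x is enumerated by I b.
    Ranked : Obj → Obj → Set
    Ranked b x = x ∈ X × ∃ λ G → Bijection G (I b) (Below x)

    rank : ∃ λ (R : Rel 2) → ∀ b x → Ap R b x ⇔ Ranked b x
    rank = relation (rel 1 ∷ [])
             (ap1 v2 v1 ∧̇ ∃̇ (rel 2) (BijF v0 (v0 ≺̇ v2) (ap1 v4 v0 ∧̇ v0 ≺̇ v3))) (X , tt)

    R : Rel 2
    R = proj₁ rank

    R-spec : ∀ b x → Ap R b x ⇔ Ranked b x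
    R-spec = proj₂ rank

    IsNext : Obj → Obj → Set
    IsNext x z = z ∈ X × x ≺ z × (∀ w → w ∈ X × x ≺ w → z ≼ w)

    next-unique : ∀ {x z z'} → IsNext x z → IsNext x z' → z ≡ z'
    next-unique (z∈X , x<z , z-least) (z'∈X , x<z' , z'-least) =
      ≼-antisym (z-least _ (z'∈X , x<z')) (z'-least _ (z∈X , x<z))

    next-injective : ∀ {x x' z} → x ∈ X → x' ∈ X → IsNext x z → IsNext x' z → x ≡ x'
    next-injective {x} {x'} x∈X x'∈X (_ , x<z , z-least) (_ , x'<z , z-least') =
      ≡-from-≮ (λ x<x' → ≼⇒≯ (z-least x' (x'∈X , x<x')) x'<z)
               (λ x'<x → ≼⇒≯ (z-least' x (x∈X , x'<x)) x<z)

    below-or-above : ∀ {x y} → y ∈ X → ¬ Below x y → ¬ y ≡ x → x ≺ y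
    below-or-above {x} {y} y∈X y≮x y≢x with ≺-total y x
    ... | inj₁ y<x = ⊥-elim (y≮x (y∈X , y<x))
    ... | inj₂ (inj₁ y≡x) = ⊥-elim (y≢x y≡x)
    ... | inj₂ (inj₂ x<y) = x<y

    below-next : ∀ {x x⁺} → x ∈ X → IsNext x x⁺ → (λ y → Below x y ⊎ y ≡ x) ≗ Below x⁺
    below-next {x} {x⁺} x∈X (_ , x<x⁺ , x⁺-least) = into , back
      where
      into : (λ y → Below x y ⊎ y ≡ x) ⊆ Below x⁺
      into y (inj₁ (y∈X , y<x)) = y∈X , ≺-trans y x x⁺ y<x x<x⁺
      into y (inj₂ refl) = x∈X , x<x⁺
      back : Below x⁺ ⊆ (λ y → Below x y ⊎ y ≡ x)
      back y (y∈X , y<x⁺) with decide (Below x y) | decide (y ≡ x)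
      ... | yes below | _ = inj₁ below
      ... | no _ | yes y≡x = inj₂ y≡x
      ... | no y≮x | no y≢x = ⊥-elim (≼⇒≯ (x⁺-least y (y∈X , below-or-above y∈X y≮x y≢x)) y<x⁺)

    below-max : ∀ {x} → x ∈ X → ¬ (∃ λ w → w ∈ X × x ≺ w) → (λ y → Below x y ⊎ y ≡ x) ≗ mem X
    below-max {x} x∈X x-max = into , back
      where
      into : (λ y → Below x y ⊎ y ≡ x) ⊆ mem X
      into y (inj₁ (y∈X , _)) = y∈X
      into y (inj₂ refl) = x∈X
      back : mem X ⊆ (λ y → Below x y ⊎ y ≡ x)
      back y y∈X with decide (Below x y) | decide (y ≡ x)
      ... | yes below | _ = inj₁ below
      ... | no _ | yes y≡x = inj₂ y≡x
      ... | no y≮x | no y≢x = ⊥-elim (x-max (y , y∈X , below-or-above y∈X y≮x y≢x))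

    -- X is nonempty (otherwise X ≅ I 0 would be finite); m is its least element.
    X-nonempty : ∃ λ x → x ∈ X
    X-nonempty with decide (∃ λ x → x ∈ X) | zero-exists
    ... | yes nonempty | _ = nonempty
    ... | no empty | z , z0 = ⊥-elim (X-infinite (z , (λ l l-limit → proj₁ l-limit z z0) , inj₁
            (someRelation , vacuous-bijection someRelation (λ x x∈X → empty (x , x∈X)) (zero-segment-empty z0))))

    minimum : ∃ λ m → m ∈ X × (∀ y → y ∈ X → m ≼ y)
    minimum = ≺-least (rel 1 ∷ []) (ap1 v1 v0) (X , tt) X-nonempty

    m : Obj
    m = proj₁ minimum

    m∈X : m ∈ X
    m∈X = proj₁ (proj₂ minimum)

    m-least : ∀ y → y ∈ X → m ≼ y
    m-least = proj₂ (proj₂ minimum)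

    ranked-zero : ∀ {z} → IsZero z → Ranked z m
    ranked-zero z0 = m∈X , someRelation ,
      vacuous-bijection someRelation (zero-segment-empty z0) (λ y (y∈X , y<m) → ≼⇒≯ (m-least y y∈X) y<m)

    -- If x is the b-th element (b finite), x has a next element x⁺, and Ī b enumerates the part
    -- of X below x⁺; were there no next element, X ≅ Ī b would be finite.
    step : ∀ {b x} → FiniteObj b → Ranked b x →
           ∃ λ x⁺ → IsNext x x⁺ × ∃ λ G → Bijection G (Ī b) (Below x⁺)
    step {b} {x} fb (x∈X , G , bG) with extend bG (≺-irrefl b) (λ x<x → ≺-irrefl x (proj₂ x<x))
    ... | G' , bG' with decide (∃ λ w → w ∈ X × x ≺ w)
    ... | no x-max = ⊥-elim (X-infinite (b , fb , inj₂
            (inverse (closedSegment-concept b) (bijection-resp bG' ≗-refl (below-max x∈X x-max)))))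
    ... | yes above with ≺-least (rel 1 ∷ obj ∷ []) (ap1 v1 v0 ∧̇ v2 ≺̇ v0) (X , x , tt) above
    ... | x⁺ , (x⁺∈X , x<x⁺) , x⁺-least =
      x⁺ , next , G' , bijection-resp bG' ≗-refl (below-next x∈X next)
      where
      next : IsNext x x⁺
      next = x⁺∈X , x<x⁺ , x⁺-least

    ranked-succ : ∀ {b c x} → FiniteObj b → IsSucc b c → Ranked b x →
                  ∃ λ x⁺ → IsNext x x⁺ × Ranked c x⁺
    ranked-succ fb sbc rk with step fb rk
    ... | x⁺ , next , G , bG = x⁺ , next , proj₁ next , G , bijection-resp bG (≗-sym (succ-segment sbc)) ≗-refl

    enumerate : ∀ {b} → FiniteObj b → ∃ (Ranked b)
    enumerate {b} fb =
      let (x , Rbx) = finite-induction (rel 2 ∷ []) (∃̇ obj (ap2 v2 v1 v0)) (R , tt) base succ-case b fb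
      in x , to (R-spec b x) Rbx
      where
      base : ∀ z → IsZero z → ∃ (Ap R z)
      base z z0 = m , from (R-spec z m) (ranked-zero z0)
      succ-case : ∀ b c → FiniteObj b → IsSucc b c → ∃ (Ap R b) → ∃ (Ap R c)
      succ-case b c fb sbc (x , Rbx) =
        let (x⁺ , _ , rk) = ranked-succ fb sbc (to (R-spec b x) Rbx) in x⁺ , from (R-spec c x⁺) rk

    -- Every finite b has a successor: if b were the largest object, then Ī b would inject
    -- into its part Below x⁺ (x⁺ as in `step`), which misses x⁺.
    has-successor : ∀ {b} → FiniteObj b → ∃ (IsSucc b)
    has-successor {b} fb with decide (∃ λ y → b ≺ y)
    ... | yes (y , b<y) = successor-exists b<y
    ... | no b-max with step fb (proj₂ (enumerate fb))
    ... | x⁺ , _ , G , bG =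
      ⊥-elim (pigeonhole (closedSegment-dfin fb) (proj₁ bG) (λ y _ → below-b y) (below-b x⁺)
                         (λ x⁺<x⁺ → ≺-irrefl x⁺ (proj₂ x⁺<x⁺)))
      where
      below-b : ∀ y → y ≼ b
      below-b y = ≯⇒≼ (λ b<y → b-max (y , b<y))

    -- The b-th element is unique: were x < x' both b-th, Below x' ≅ I b ≅ Below x would inject
    -- the Dedekind-finite Below x' into its part Below x, which misses x.
    ranked-unique : ∀ {b x x'} → FiniteObj b → Ranked b x → Ranked b x' → x ≡ x'
    ranked-unique {b} fb rk rk' = ≡-from-≮ (not-below rk rk') (not-below rk' rk)
      where
      not-below : ∀ {x x'} → Ranked b x → Ranked b x' → ¬ x ≺ x'
      not-below {x} {x'} (x∈X , G , bG) (_ , G' , bG') x<x' with inverse (segment-concept b) bG'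
      ... | _ , bG'⁻¹ with compose-injections (proj₁ bG'⁻¹) (proj₁ bG)
      ... | _ , jH = pigeonhole (transfer (segment-concept b) bG' (segment-dfin fb)) jH
                       (λ y (y∈X , y<x) → y∈X , ≺-trans y x x' y<x x<x') (x∈X , x<x')
                       (λ x<x → ≺-irrefl x (proj₂ x<x))

    -- An element has only one finite rank: were x both b-th and b'-th with b < b', then
    -- I b' ≅ Below x ≅ I b would inject I b' into its part I b, which misses b.
    rank-unique : ∀ {b b' x} → FiniteObj b → FiniteObj b' → Ranked b x → Ranked b' x → b ≡ b'
    rank-unique fb fb' rk rk' = ≡-from-≮ (not-below fb' rk rk') (not-below fb rk' rk)
      where
      not-below : ∀ {b b' x} → FiniteObj b' → Ranked b x → Ranked b' x → ¬ b ≺ b'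
      not-below {b} {b'} fb' (_ , G , bG) (_ , G' , bG') b<b' with inverse (segment-concept b) bG
      ... | _ , bG⁻¹ with compose-injections (proj₁ bG') (proj₁ bG⁻¹)
      ... | _ , jH = pigeonhole (segment-dfin fb') jH (λ y y<b → ≺-trans y b b' y<b b<b') b<b' (≺-irrefl b)

    enumeration-injection : ∀ {ω} → IsLeastLimit ω → Injection R (I ω) (mem X)
    enumeration-injection {ω} (_ , ω-least) = (total , functional) , injective
      where
      finite : ∀ {b} → b ≺ ω → FiniteObj b
      finite b<ω l l-limit = ≺≼-trans b<ω (ω-least l l-limit)
      total : ∀ b → b ≺ ω → ∃ λ x → x ∈ X × Ap R b x
      total b b<ω = let (x , rk) = enumerate (finite b<ω) in x , proj₁ rk , from (R-spec b x) rk
      functional : ∀ b x x' → b ≺ ω → Ap R b x → Ap R b x' → x ≡ x'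
      functional b x x' b<ω Rbx Rbx' = ranked-unique (finite b<ω) (to (R-spec b x) Rbx) (to (R-spec b x') Rbx')
      injective : IsInj R (I ω)
      injective b b' x b<ω b'<ω Rbx Rb'x =
        rank-unique (finite b<ω) (finite b'<ω) (to (R-spec b x) Rbx) (to (R-spec b' x) Rb'x)

    HasFiniteRank : Pred
    HasFiniteRank x = ∃ λ b → FiniteObj b × Ranked b x

    finitelyRanked : ∃ λ (C : Rel 1) → ∀ x → x ∈ C ⇔ (∃ λ b → FiniteObj b × Ap R b x)
    finitelyRanked = concept (rel 2 ∷ []) (∃̇ obj (FiniteF ∧̇ ap2 v2 v0 v1)) (R , tt)

    C : Rel 1
    C = proj₁ finitelyRanked

    C-spec : ∀ x → x ∈ C ⇔ HasFiniteRank x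
    C-spec x = mk⇔ (λ x∈C → let (b , fb , Rbx) = to (proj₂ finitelyRanked x) x∈C in b , fb , to (R-spec b x) Rbx)
                   (λ (b , fb , rk) → from (proj₂ finitelyRanked x) (b , fb , from (R-spec b x) rk))

    C⊆X : mem C ⊆ mem X
    C⊆X x x∈C = proj₁ (proj₂ (proj₂ (to (C-spec x) x∈C)))

    nextRelation : ∃ λ (N : Rel 2) → ∀ x z → Ap N x z ⇔ IsNext x z
    nextRelation = relation (rel 1 ∷ [])
             (ap1 v2 v1 ∧̇ v0 ≺̇ v1 ∧̇ ∀̇ obj ((ap1 v3 v0 ∧̇ v1 ≺̇ v0) ⇒̇ v2 ≼̇ v0)) (X , tt)

    N : Rel 2
    N = proj₁ nextRelation

    N-spec : ∀ x z → Ap N x z ⇔ IsNext x z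
    N-spec = proj₂ nextRelation

    -- The next-element map sends C injectively into C (the next element after the b-th is
    -- the successor(b)-th).
    next-injection : Injection N (mem C) (mem C)
    next-injection = (total , functional) , injective
      where
      total : ∀ x → x ∈ C → ∃ λ z → z ∈ C × Ap N x z
      total x x∈C =
        let (b , fb , rk) = to (C-spec x) x∈C
            (c , sbc) = has-successor fb
            (x⁺ , next , rk⁺) = ranked-succ fb sbc rk
        in x⁺ , from (C-spec x⁺) (c , fin-succ fb sbc , rk⁺) , from (N-spec x x⁺) next
      functional : ∀ x z z' → x ∈ C → Ap N x z → Ap N x z' → z ≡ z'
      functional x z z' _ Nxz Nxz' = next-unique (to (N-spec x z) Nxz) (to (N-spec x z') Nxz')
      injective : IsInj N (mem C)
      injective x x' z x∈C x'∈C Nxz Nx'z =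
        next-injective (C⊆X x x∈C) (C⊆X x' x'∈C) (to (N-spec x z) Nxz) (to (N-spec x' z) Nx'z)

    m∈C : m ∈ C
    m∈C = let (z , z0) = zero-exists
          in from (C-spec m) (z , (λ l l-limit → proj₁ l-limit z z0) , ranked-zero z0)

    -- X is Dedekind infinite: otherwise so would be C, yet m ∈ C is not a next element.
    dedekind-infinite : ¬ DedekindFinite X
    dedekind-infinite dX =
      let (x , x∈C , Nxm) = dfin-subconcept C X C⊆X dX N next-injection m m∈C
      in ≼⇒≯ (m-least x (C⊆X x x∈C)) (proj₁ (proj₂ (to (N-spec x m) Nxm)))

  dfin⇒finite : ∀ X → DedekindFinite X → FiniteConcept X
  dfin⇒finite X dX with decide (FiniteConcept X)
  ... | yes finite = finite
  ... | no infinite = ⊥-elim (Enumeration.dedekind-infinite X infinite dX)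

  infinite⇒embedding : ∀ {ω X} → IsLeastLimit ω → InfiniteConcept X →
                       ∃ λ ι → Injection ι (I ω) (mem X)
  infinite⇒embedding {X = X} lω infinite =
    Enumeration.R X infinite , Enumeration.enumeration-injection X infinite lω

  -- I ω does not inject into I d for finite d: restricted to Ī d ⊆ I ω it would inject Ī d
  -- into its part I d, which misses d.
  no-embedding-into-segment : ∀ {ω d H} → IsLeastLimit ω → FiniteObj d → Injection H (I ω) (I d) → ⊥
  no-embedding-into-segment {d = d} (ω-limit , _) fd jH =
    pigeonhole (closedSegment-dfin fd) (injection-mono jH (λ y y≤d → ≼≺-trans y≤d (fd _ ω-limit)) ⊆-refl)
               (λ _ → inj₁) (inj₂ refl) (≺-irrefl d)

  -- A finite concept X ≅ I a, or X ≅ Ī a = I (a + 1), does not receive an injection from I ω.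
  embedding⇒infinite : ∀ {ω X} → IsLeastLimit ω → (∃ λ ι → Injection ι (I ω) (mem X)) → InfiniteConcept X
  embedding⇒infinite lω (ι , jι) (a , fa , inj₁ (F , bF)) =
    no-embedding-into-segment lω fa (proj₂ (compose-injections jι (proj₁ bF)))
  embedding⇒infinite lω (ι , jι) (a , fa , inj₂ (F , bF)) =
    let (c , sac) = successor-exists (fa _ (proj₁ lω))
    in no-embedding-into-segment lω (fin-succ fa sac)
         (injection-mono (proj₂ (compose-injections jι (proj₁ bF))) ⊆-refl (proj₂ (succ-segment sac)))

proposition4 : ExcludedMiddle 0ℓ → (M : Structure) → Axioms M →
    let open Notions M in
    (∀ (X : Rel 1) → FiniteConcept X ⇔ DedekindFinite X)
    × (∀ (ω : Obj) → IsLeastLimit ω → ∀ (X : Rel 1) →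
        (InfiniteConcept X ⇔ (∃ λ (ι : Rel 2) → Injection ι (I ω) (mem X)))
        × ((∃ λ (ι : Rel 2) → Injection ι (I ω) (mem X)) ⇔ DedekindInfinite X))
proposition4 em M axioms =
  (λ X → mk⇔ (finite⇒dfin X) (dfin⇒finite X)) ,
  λ ω lω X →
    mk⇔ (infinite⇒embedding lω) (embedding⇒infinite lω) ,
    mk⇔ (λ embedding dX → embedding⇒infinite lω embedding (dfin⇒finite X dX))
        (λ ¬dX → infinite⇒embedding lω (λ finite → ¬dX (finite⇒dfin X finite)))
  where open Proposition4 em M axioms
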